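{- Let $G$ be a locally balanced spanning subgraph of $K_{n,n,n}$ (with respect to the three parts of $K_{n,n,n}$). Let $K$ be the matrix of orthogonal projection of $\mathbb{R}^{E(K_{n,n,n})}$ onto $\ker(M)$, where $M = WW^\top$ and $W$ is the inclusion matrix of $E(K_{n,n,n})$ versus the set of triangles of $K_{n,n,n}$. Then $K[G]\mathbf{1} = \mathbf{0}$, where $\mathbf{1}$ is the all-ones vector in $\mathbb{R}^{E(G)}$.
   Context: $K_{n,n,n}$ is the complete $3$-partite graph with three parts of size $n$. The inclusion matrix of edges versus triangles has $(e,t)$-entry $1$ if $e\subseteq t$ and $0$ otherwise. A $3$-partite graph is locally balanced if every vertex has the same number of neighbours in each of the two parts other than its own. For a square matrix $A$ with rows and columns indexed by $E(K_{n,n,n})$ and a spanning subgraph $G$, $A[G]$ denotes the principal submatrix with rows and columns indexed by $E(G)$.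
   Formalization: The matrix K and the vectors it acts on have rational entries, so K is the orthogonal projection onto ker(M) within the rational edge space rather than $\mathbb{R}^{E(K_{n,n,n})}$. -}

module Defs where

open import Data.Nat using (ℕ; zero; suc)
open import Data.Fin using (Fin; zero; suc; _≟_)
open import Data.Product using (_×_; _,_; proj₁; proj₂)
open import Data.Bool using (Bool; true; false; if_then_else_; _∧_; _∨_)
open import Data.Rational using (ℚ; 0ℚ; 1ℚ; _+_; _*_)
open import Relation.Nullary.Decidable using (⌊_⌋)
open import Relation.Binary.PropositionalEquality using (_≡_; _≢_)

sumFin : (n : ℕ) → (Fin n → ℚ) → ℚ
sumFin zero    f = 0ℚ
sumFin (suc n) f = f zero + sumFin n (λ i → f (suc i))

countFin : (n : ℕ) → (Fin n → Bool) → ℕ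
countFin zero    f = zero
countFin (suc n) f = (if f zero then 1 else 0) Data.Nat.+ countFin n (λ i → f (suc i))

anyFin : (n : ℕ) → (Fin n → Bool) → Bool
anyFin zero    f = false
anyFin (suc n) f = f zero ∨ anyFin n (λ i → f (suc i))

Vertex : ℕ → Set
Vertex n = Fin 3 × Fin n

-- An edge of K_{n,n,n} is encoded as (k , a , b): k is the part NOT met
-- by the edge; a is the index of the endpoint in the smaller remaining
-- part, b that in the larger remaining part.  This is a bijection with
-- E(K_{n,n,n}).
Edge : ℕ → Set
Edge n = Fin 3 × Fin n × Fin n

lowPart highPart : Fin 3 → Fin 3
lowPart zero = suc zero
lowPart (suc zero) = zero
lowPart (suc (suc zero)) = zero
highPart zero = suc (suc zero)
highPart (suc zero) = suc (suc zero)
highPart (suc (suc zero)) = suc zero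

end₁ end₂ : ∀ {n} → Edge n → Vertex n
end₁ (k , a , b) = lowPart k , a
end₂ (k , a , b) = highPart k , b

Triangle : ℕ → Set
Triangle n = Fin 3 → Fin n

vertexInTriangle : ∀ {n} → Vertex n → Triangle n → Bool
vertexInTriangle (p , a) t = ⌊ t p ≟ a ⌋

edgeInTriangle : ∀ {n} → Edge n → Triangle n → Bool
edgeInTriangle e t = vertexInTriangle (end₁ e) t ∧ vertexInTriangle (end₂ e) t

sumEdge : (n : ℕ) → (Edge n → ℚ) → ℚ
sumEdge n f = sumFin 3 (λ k → sumFin n (λ a → sumFin n (λ b → f (k , a , b))))

sumTriangle : (n : ℕ) → (Triangle n → ℚ) → ℚ
sumTriangle n f = sumFin n (λ x → sumFin n (λ y → sumFin n (λ z →
  f (λ { zero → x ; (suc zero) → y ; (suc (suc zero)) → z }))))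

W : (n : ℕ) → Edge n → Triangle n → ℚ
W n e t = if edgeInTriangle e t then 1ℚ else 0ℚ

M : (n : ℕ) → Edge n → Edge n → ℚ
M n e f = sumTriangle n (λ t → W n e t * W n f t)

-- K is the matrix of orthogonal projection onto ker M:
--  range K ⊆ ker M, K fixes ker M, and K is symmetric.
IsOrthProjOntoKerM : (n : ℕ) → (Edge n → Edge n → ℚ) → Set
IsOrthProjOntoKerM n K =
  (∀ e f → sumEdge n (λ g → M n e g * K g f) ≡ 0ℚ) ×
  ((x : Edge n → ℚ) → (∀ e → sumEdge n (λ f → M n e f * x f) ≡ 0ℚ) →
     ∀ e → sumEdge n (λ f → K e f * x f) ≡ x e) ×
  (∀ e f → K e f ≡ K f e)

Subgraph : ℕ → Set
Subgraph n = Edge n → Bool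

vertexEq : ∀ {n} → Vertex n → Vertex n → Bool
vertexEq (p , a) (q , b) = ⌊ p ≟ q ⌋ ∧ ⌊ a ≟ b ⌋

adj : ∀ {n} → Subgraph n → Vertex n → Vertex n → Bool
adj {n} G u v = anyFin 3 (λ k → anyFin n (λ a → anyFin n (λ b →
  G (k , a , b) ∧
  ((vertexEq (end₁ (k , a , b)) u ∧ vertexEq (end₂ (k , a , b)) v) ∨
   (vertexEq (end₁ (k , a , b)) v ∧ vertexEq (end₂ (k , a , b)) u)))))

degIn : ∀ {n} → Subgraph n → Vertex n → Fin 3 → ℕ
degIn {n} G v q = countFin n (λ b → adj G v (q , b))

LocallyBalanced : ∀ {n} → Subgraph n → Set
LocallyBalanced {n} G = ∀ (p : Fin 3) (a : Fin n) (q r : Fin 3) →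
  q ≢ p → r ≢ p → degIn G (p , a) q ≡ degIn G (p , a) r

principalTimesOnes : (n : ℕ) → (Edge n → Edge n → ℚ) → Subgraph n → Edge n → ℚ
principalTimesOnes n K G e = sumEdge n (λ f → if G f then K e f else 0ℚ)

-- Since K is symmetric and M K = 0, every column x = K e lies in ker M, and
-- xᵀ M x = |Wᵀ x|² shows that x sums to zero around every triangle.  Such an
-- edge weighting comes from vertex potentials: x(uv) = φ(u, part v) + φ(v, part u)
-- with φ(v, q) + φ(v, r) = 0 for the two parts q, r not containing v.  Summing
-- over E(G) gives Σ_v Σ_q φ(v, q) deg_q(v), which vanishes when G is locally
-- balanced, because then deg_q(v) = deg_r(v).

module Submission where

open import Defs
open import Data.Nat as ℕ using (ℕ; zero; suc)
open import Data.Fin as Fin using (Fin; zero; suc; _≟_)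
import Data.Fin.Properties as Finₚ
open import Data.Product using (_×_; _,_; proj₁; proj₂; ∃)
open import Data.Product.Properties using (,-injective)
open import Data.Product.Function.NonDependent.Propositional using (_×-⇔_)
open import Data.Sum using (_⊎_; inj₁; inj₂)
open import Data.Sum.Function.Propositional using (_⊎-⇔_)
open import Data.Bool using (Bool; true; false; if_then_else_; _∧_; _∨_; T)
open import Data.Bool.Properties using (T-∧; T-∨; T-≡; ⇔→≡)
open import Data.Empty using (⊥; ⊥-elim)
open import Data.Rational using (ℚ; 0ℚ; 1ℚ; _+_; _*_; -_; _≤_; _<_; positive; negative)
import Data.Rational.Properties as ℚₚ
open import Data.Rational.Solver using (module +-*-Solver)
open import Function using (_∘_)
open import Function.Bundles using (_⇔_; mk⇔; Equivalence)
open import Function.Construct.Composition using (_⇔-∘_)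
open import Function.Construct.Identity using (⇔-id)
open import Function.Construct.Symmetry using (⇔-sym)
open import Relation.Binary.Definitions using (tri<; tri≈; tri>)
open import Relation.Binary.PropositionalEquality
open import Relation.Nullary.Decidable using (⌊_⌋; yes; no; toWitness; fromWitness)

open +-*-Solver
open Equivalence using (to; from)
open ≡-Reasoning

pattern p₀ = zero
pattern p₁ = suc zero
pattern p₂ = suc (suc zero)

𝟙 : Bool → ℚ
𝟙 b = if b then 1ℚ else 0ℚ

if-then-0≡𝟙* : ∀ b v → (if b then v else 0ℚ) ≡ 𝟙 b * v
if-then-0≡𝟙* true  v = sym (ℚₚ.*-identityˡ v)
if-then-0≡𝟙* false v = sym (ℚₚ.*-zeroˡ v)

𝟙-∧ : ∀ p q → 𝟙 (p ∧ q) ≡ 𝟙 p * 𝟙 q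
𝟙-∧ true  q = sym (ℚₚ.*-identityˡ (𝟙 q))
𝟙-∧ false q = sym (ℚₚ.*-zeroˡ (𝟙 q))

𝟙-≟-refl : ∀ {n} (a : Fin n) → 𝟙 ⌊ a ≟ a ⌋ ≡ 1ℚ
𝟙-≟-refl a with a ≟ a
... | yes _  = refl
... | no a≢a = ⊥-elim (a≢a refl)

𝟙-≟-≢ : ∀ {n} {a b : Fin n} → a ≢ b → 𝟙 ⌊ a ≟ b ⌋ ≡ 0ℚ
𝟙-≟-≢ {a = a} {b} a≢b with a ≟ b
... | yes a≡b = ⊥-elim (a≢b a≡b)
... | no _    = refl

sumFin-cong : ∀ n {f g : Fin n → ℚ} → (∀ i → f i ≡ g i) → sumFin n f ≡ sumFin n g
sumFin-cong zero    f≗g = refl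
sumFin-cong (suc n) f≗g = cong₂ _+_ (f≗g zero) (sumFin-cong n (f≗g ∘ suc))

sumFin-+ : ∀ n (f g : Fin n → ℚ) → sumFin n (λ i → f i + g i) ≡ sumFin n f + sumFin n g
sumFin-+ zero    f g = sym (ℚₚ.+-identityˡ 0ℚ)
sumFin-+ (suc n) f g = begin
  (f zero + g zero) + sumFin n (λ i → f (suc i) + g (suc i))
    ≡⟨ cong ((f zero + g zero) +_) (sumFin-+ n (f ∘ suc) (g ∘ suc)) ⟩
  (f zero + g zero) + (sumFin n (f ∘ suc) + sumFin n (g ∘ suc))
    ≡⟨ solve 4 (λ a b c d → (a :+ b) :+ (c :+ d) := (a :+ c) :+ (b :+ d)) refl
         (f zero) (g zero) (sumFin n (f ∘ suc)) (sumFin n (g ∘ suc)) ⟩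
  (f zero + sumFin n (f ∘ suc)) + (g zero + sumFin n (g ∘ suc)) ∎

sumFin-*ˡ : ∀ n c (f : Fin n → ℚ) → sumFin n (λ i → c * f i) ≡ c * sumFin n f
sumFin-*ˡ zero    c f = sym (ℚₚ.*-zeroʳ c)
sumFin-*ˡ (suc n) c f =
  trans (cong (c * f zero +_) (sumFin-*ˡ n c (f ∘ suc))) (sym (ℚₚ.*-distribˡ-+ c _ _))

record Summation (A : Set) : Set₁ where
  field
    sum      : (A → ℚ) → ℚ
    sum-cong : ∀ {f g} → (∀ a → f a ≡ g a) → sum f ≡ sum g
    sum-+    : ∀ f g → sum (λ a → f a + g a) ≡ sum f + sum g
    sum-*ˡ   : ∀ c f → sum (λ a → c * f a) ≡ c * sum f

  sum-zero : sum (λ _ → 0ℚ) ≡ 0ℚ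
  sum-zero = begin
    sum (λ _ → 0ℚ)         ≡⟨ sum-cong (λ _ → sym (ℚₚ.*-zeroˡ 0ℚ)) ⟩
    sum (λ _ → 0ℚ * 0ℚ)    ≡⟨ sum-*ˡ 0ℚ (λ _ → 0ℚ) ⟩
    0ℚ * sum (λ _ → 0ℚ)    ≡⟨ ℚₚ.*-zeroˡ (sum (λ _ → 0ℚ)) ⟩
    0ℚ                     ∎

  sum-*ʳ : ∀ c f → sum (λ a → f a * c) ≡ sum f * c
  sum-*ʳ c f = trans (sum-cong (λ a → ℚₚ.*-comm (f a) c))
                     (trans (sum-*ˡ c f) (ℚₚ.*-comm c (sum f)))

  sum-sumFin-swap : ∀ n (f : A → Fin n → ℚ) →
    sum (λ a → sumFin n (f a)) ≡ sumFin n (λ i → sum (λ a → f a i))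
  sum-sumFin-swap zero    f = sum-zero
  sum-sumFin-swap (suc n) f =
    trans (sum-+ _ _) (cong (sum (λ a → f a zero) +_) (sum-sumFin-swap n (λ a → f a ∘ suc)))

  sum-sumTriangle-swap : ∀ n (f : A → Triangle n → ℚ) →
    sum (λ a → sumTriangle n (f a)) ≡ sumTriangle n (λ t → sum (λ a → f a t))
  sum-sumTriangle-swap n f =
    trans (sum-sumFin-swap n _) (sumFin-cong n λ x → trans (sum-sumFin-swap n _)
      (sumFin-cong n λ y → sum-sumFin-swap n _))

open Summation

sumFin-summation : ∀ n → Summation (Fin n)
sumFin-summation n = record
  { sum = sumFin n ; sum-cong = sumFin-cong n ; sum-+ = sumFin-+ n ; sum-*ˡ = sumFin-*ˡ n }

×-summation : ∀ {A B} → Summation A → Summation B → Summation (A × B)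
×-summation SA SB = record
  { sum      = λ f → sum SA (λ a → sum SB (λ b → f (a , b)))
  ; sum-cong = λ f≗g → sum-cong SA (λ a → sum-cong SB (λ b → f≗g (a , b)))
  ; sum-+    = λ f g → trans (sum-cong SA (λ a → sum-+ SB _ _)) (sum-+ SA _ _)
  ; sum-*ˡ   = λ c f → trans (sum-cong SA (λ a → sum-*ˡ SB c _)) (sum-*ˡ SA c _)
  }

edge-summation : ∀ n → Summation (Edge n)
edge-summation n = ×-summation (sumFin-summation 3) (×-summation (sumFin-summation n) (sumFin-summation n))

triangle-summation : ∀ n → Summation (Triangle n)
triangle-summation n = record
  { sum      = sumTriangle n
  ; sum-cong = λ f≗g → sum-cong S³ (λ _ → f≗g _)
  ; sum-+    = λ f g → sum-+ S³ _ _
  ; sum-*ˡ   = λ c f → sum-*ˡ S³ c _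
  }
  where
  S³ : Summation (Fin n × Fin n × Fin n)
  S³ = ×-summation (sumFin-summation n) (×-summation (sumFin-summation n) (sumFin-summation n))

sumFin-zero : ∀ n → sumFin n (λ _ → 0ℚ) ≡ 0ℚ
sumFin-zero n = sum-zero (sumFin-summation n)

sumFin-neg-*ˡ : ∀ n (f g : Fin n → ℚ) → sumFin n (λ i → - f i * g i) ≡ - sumFin n (λ i → f i * g i)
sumFin-neg-*ˡ zero    f g = refl
sumFin-neg-*ˡ (suc n) f g = begin
  - f zero * g zero + sumFin n (λ i → - f (suc i) * g (suc i))
    ≡⟨ cong₂ _+_ (sym (ℚₚ.neg-distribˡ-* (f zero) (g zero))) (sumFin-neg-*ˡ n (f ∘ suc) (g ∘ suc)) ⟩
  - (f zero * g zero) + - sumFin n (λ i → f (suc i) * g (suc i))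
    ≡⟨ sym (ℚₚ.neg-distrib-+ (f zero * g zero) _) ⟩
  - sumFin (suc n) (λ i → f i * g i) ∎

sumFin-point : ∀ n (j : Fin n) (f : Fin n → ℚ) → (∀ i → i ≢ j → f i ≡ 0ℚ) → sumFin n f ≡ f j
sumFin-point (suc n) zero f off = begin
  f zero + sumFin n (f ∘ suc)       ≡⟨ cong (f zero +_) (sumFin-cong n (λ i → off (suc i) λ ())) ⟩
  f zero + sumFin n (λ _ → 0ℚ)      ≡⟨ cong (f zero +_) (sumFin-zero n) ⟩
  f zero + 0ℚ                       ≡⟨ ℚₚ.+-identityʳ (f zero) ⟩
  f zero                            ∎
sumFin-point (suc n) (suc j) f off = begin
  f zero + sumFin n (f ∘ suc)   ≡⟨ cong (_+ sumFin n (f ∘ suc)) (off zero λ ()) ⟩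
  0ℚ + sumFin n (f ∘ suc)       ≡⟨ ℚₚ.+-identityˡ _ ⟩
  sumFin n (f ∘ suc)            ≡⟨ sumFin-point n j (f ∘ suc) (λ i i≢j → off (suc i) (i≢j ∘ Finₚ.suc-injective)) ⟩
  f (suc j)                     ∎

sumFin-δ : ∀ n (j : Fin n) (f : Fin n → ℚ) → sumFin n (λ i → 𝟙 ⌊ j ≟ i ⌋ * f i) ≡ f j
sumFin-δ n j f = begin
  sumFin n (λ i → 𝟙 ⌊ j ≟ i ⌋ * f i)
    ≡⟨ sumFin-point n j _ (λ i i≢j → trans (cong (_* f i) (𝟙-≟-≢ (i≢j ∘ sym))) (ℚₚ.*-zeroˡ (f i))) ⟩
  𝟙 ⌊ j ≟ j ⌋ * f j   ≡⟨ cong (_* f j) (𝟙-≟-refl j) ⟩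
  1ℚ * f j            ≡⟨ ℚₚ.*-identityˡ (f j) ⟩
  f j                 ∎

sumFin²-δ : ∀ n (j k : Fin n) (f : Fin n → Fin n → ℚ) →
  sumFin n (λ a → sumFin n (λ b → 𝟙 (⌊ j ≟ a ⌋ ∧ ⌊ k ≟ b ⌋) * f a b)) ≡ f j k
sumFin²-δ n j k f = begin
  sumFin n (λ a → sumFin n (λ b → 𝟙 (⌊ j ≟ a ⌋ ∧ ⌊ k ≟ b ⌋) * f a b))
    ≡⟨ sumFin-cong n (λ a → sumFin-cong n (λ b → factor a b)) ⟩
  sumFin n (λ a → sumFin n (λ b → 𝟙 ⌊ j ≟ a ⌋ * (𝟙 ⌊ k ≟ b ⌋ * f a b)))
    ≡⟨ sumFin-cong n (λ a → sumFin-*ˡ n (𝟙 ⌊ j ≟ a ⌋) _) ⟩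
  sumFin n (λ a → 𝟙 ⌊ j ≟ a ⌋ * sumFin n (λ b → 𝟙 ⌊ k ≟ b ⌋ * f a b))
    ≡⟨ sumFin-δ n j _ ⟩
  sumFin n (λ b → 𝟙 ⌊ k ≟ b ⌋ * f j b)
    ≡⟨ sumFin-δ n k (f j) ⟩
  f j k ∎
  where
  factor : ∀ a b → 𝟙 (⌊ j ≟ a ⌋ ∧ ⌊ k ≟ b ⌋) * f a b ≡ 𝟙 ⌊ j ≟ a ⌋ * (𝟙 ⌊ k ≟ b ⌋ * f a b)
  factor a b = trans (cong (_* f a b) (𝟙-∧ ⌊ j ≟ a ⌋ ⌊ k ≟ b ⌋)) (ℚₚ.*-assoc (𝟙 ⌊ j ≟ a ⌋) (𝟙 ⌊ k ≟ b ⌋) (f a b))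

sumFin²-separable : ∀ n (g : Fin n → Fin n → ℚ) (α β : Fin n → ℚ) →
  sumFin n (λ a → sumFin n (λ b → g a b * (α a + β b))) ≡
  sumFin n (λ a → α a * sumFin n (g a)) + sumFin n (λ b → β b * sumFin n (λ a → g a b))
sumFin²-separable n g α β = begin
  sumFin n (λ a → sumFin n (λ b → g a b * (α a + β b)))
    ≡⟨ sumFin-cong n (λ a → sumFin-cong n (λ b → distrib (g a b) (α a) (β b))) ⟩
  sumFin n (λ a → sumFin n (λ b → α a * g a b + β b * g a b))
    ≡⟨ sumFin-cong n (λ a → sumFin-+ n _ _) ⟩
  sumFin n (λ a → sumFin n (λ b → α a * g a b) + sumFin n (λ b → β b * g a b))
    ≡⟨ sumFin-+ n _ _ ⟩
  sumFin n (λ a → sumFin n (λ b → α a * g a b)) + sumFin n (λ a → sumFin n (λ b → β b * g a b))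
    ≡⟨ cong₂ _+_ (sumFin-cong n (λ a → sumFin-*ˡ n (α a) (g a))) (sum-sumFin-swap (sumFin-summation n) n (λ a b → β b * g a b)) ⟩
  sumFin n (λ a → α a * sumFin n (g a)) + sumFin n (λ b → sumFin n (λ a → β b * g a b))
    ≡⟨ cong (sumFin n (λ a → α a * sumFin n (g a)) +_) (sumFin-cong n (λ b → sumFin-*ˡ n (β b) (λ a → g a b))) ⟩
  sumFin n (λ a → α a * sumFin n (g a)) + sumFin n (λ b → β b * sumFin n (λ a → g a b)) ∎
  where
  distrib : ∀ x y z → x * (y + z) ≡ y * x + z * x
  distrib = solve 3 (λ x y z → x :* (y :+ z) := y :* x :+ z :* x) refl

square-pos : ∀ {q} → q ≢ 0ℚ → 0ℚ < q * q
square-pos {q} q≢0 with ℚₚ.<-cmp 0ℚ q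
... | tri< 0<q _ _ = subst (_< q * q) (ℚₚ.*-zeroˡ q) (ℚₚ.*-monoˡ-<-pos q {{positive 0<q}} 0<q)
... | tri≈ _ 0≡q _ = ⊥-elim (q≢0 (sym 0≡q))
... | tri> _ _ q<0 = subst (_< q * q) (ℚₚ.*-zeroˡ q) (ℚₚ.*-monoˡ-<-neg q {{negative q<0}} q<0)

square-nonneg : ∀ q → 0ℚ ≤ q * q
square-nonneg q with q ℚₚ.≟ 0ℚ
... | yes refl = ℚₚ.≤-refl
... | no q≢0   = ℚₚ.<⇒≤ (square-pos q≢0)

square≡0⇒≡0 : ∀ {q} → q * q ≡ 0ℚ → q ≡ 0ℚ
square≡0⇒≡0 {q} q²≡0 with q ℚₚ.≟ 0ℚ
... | yes q≡0 = q≡0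
... | no q≢0  = ⊥-elim (ℚₚ.<-irrefl (sym q²≡0) (square-pos q≢0))

nonneg+nonneg≡0 : ∀ {p q} → 0ℚ ≤ p → 0ℚ ≤ q → p + q ≡ 0ℚ → p ≡ 0ℚ × q ≡ 0ℚ
nonneg+nonneg≡0 {p} {q} 0≤p 0≤q p+q≡0 =
  ℚₚ.≤-antisym p≤0 0≤p , ℚₚ.≤-antisym q≤0 0≤q
  where
  p≤0 : p ≤ 0ℚ
  p≤0 = subst₂ _≤_ (ℚₚ.+-identityʳ p) p+q≡0 (ℚₚ.+-monoʳ-≤ p 0≤q)
  q≤0 : q ≤ 0ℚ
  q≤0 = subst₂ _≤_ (ℚₚ.+-identityˡ q) p+q≡0 (ℚₚ.+-monoˡ-≤ q 0≤p)

sumFin-nonneg : ∀ n {f : Fin n → ℚ} → (∀ i → 0ℚ ≤ f i) → 0ℚ ≤ sumFin n f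
sumFin-nonneg zero    0≤f = ℚₚ.≤-refl
sumFin-nonneg (suc n) 0≤f = ℚₚ.+-mono-≤ (0≤f zero) (sumFin-nonneg n (0≤f ∘ suc))

sumFin-nonneg≡0 : ∀ n {f : Fin n → ℚ} → (∀ i → 0ℚ ≤ f i) → sumFin n f ≡ 0ℚ → ∀ i → f i ≡ 0ℚ
sumFin-nonneg≡0 (suc n) 0≤f Σf≡0 zero    =
  proj₁ (nonneg+nonneg≡0 (0≤f zero) (sumFin-nonneg n (0≤f ∘ suc)) Σf≡0)
sumFin-nonneg≡0 (suc n) 0≤f Σf≡0 (suc i) =
  sumFin-nonneg≡0 n (0≤f ∘ suc) (proj₂ (nonneg+nonneg≡0 (0≤f zero) (sumFin-nonneg n (0≤f ∘ suc)) Σf≡0)) i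

sumFin³-squares≡0 : ∀ n {h : Fin n → Fin n → Fin n → ℚ} →
  sumFin n (λ a → sumFin n (λ b → sumFin n (λ c → h a b c * h a b c))) ≡ 0ℚ →
  ∀ a b c → h a b c ≡ 0ℚ
sumFin³-squares≡0 n {h} Σh²≡0 a b c = square≡0⇒≡0
  (sumFin-nonneg≡0 n (λ c → square-nonneg (h a b c))
    (sumFin-nonneg≡0 n (λ b → sumFin-nonneg n (λ c → square-nonneg (h a b c)))
      (sumFin-nonneg≡0 n (λ a → sumFin-nonneg n (λ b → sumFin-nonneg n (λ c → square-nonneg (h a b c))))
        Σh²≡0 a) b) c)

Wᵀ : (n : ℕ) → (Edge n → ℚ) → Triangle n → ℚ
Wᵀ n x t = sumEdge n (λ g → W n g t * x g)

-- The edges (p₀ , b , c), (p₁ , a , c), (p₂ , a , b) are the three sides of the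
-- triangle meeting the parts in a, b and c.
VanishesOnTriangles : (n : ℕ) → (Edge n → ℚ) → Set
VanishesOnTriangles n x = ∀ a b c → x (p₀ , b , c) + (x (p₁ , a , c) + x (p₂ , a , b)) ≡ 0ℚ

module _ (n : ℕ) (x : Edge n → ℚ) where
  private
    E  = edge-summation n
    Tr = triangle-summation n

  Wᵀ-triangle : ∀ t →
    Wᵀ n x t ≡ x (p₀ , t p₁ , t p₂) + (x (p₁ , t p₀ , t p₂) + (x (p₂ , t p₀ , t p₁) + 0ℚ))
  Wᵀ-triangle t =
    cong₂ _+_ (sumFin²-δ n (t p₁) (t p₂) _)
      (cong₂ _+_ (sumFin²-δ n (t p₀) (t p₂) _)
        (cong (_+ 0ℚ) (sumFin²-δ n (t p₀) (t p₁) _)))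

  M≡WWᵀ : ∀ e → sumEdge n (λ g → M n e g * x g) ≡ sumTriangle n (λ t → W n e t * Wᵀ n x t)
  M≡WWᵀ e = begin
    sumEdge n (λ g → M n e g * x g)
      ≡⟨ sum-cong E (λ g → sym (sum-*ʳ Tr (x g) (λ t → W n e t * W n g t))) ⟩
    sumEdge n (λ g → sumTriangle n (λ t → W n e t * W n g t * x g))
      ≡⟨ sum-cong E (λ g → sum-cong Tr (λ t → ℚₚ.*-assoc (W n e t) (W n g t) (x g))) ⟩
    sumEdge n (λ g → sumTriangle n (λ t → W n e t * (W n g t * x g)))
      ≡⟨ sum-sumTriangle-swap E n (λ g t → W n e t * (W n g t * x g)) ⟩
    sumTriangle n (λ t → sumEdge n (λ g → W n e t * (W n g t * x g)))
      ≡⟨ sum-cong Tr (λ t → sum-*ˡ E (W n e t) (λ g → W n g t * x g)) ⟩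
    sumTriangle n (λ t → W n e t * Wᵀ n x t) ∎

  quadratic-form-M : sumEdge n (λ e → x e * sumEdge n (λ g → M n e g * x g)) ≡
                     sumTriangle n (λ t → Wᵀ n x t * Wᵀ n x t)
  quadratic-form-M = begin
    sumEdge n (λ e → x e * sumEdge n (λ g → M n e g * x g))
      ≡⟨ sum-cong E (λ e → cong (x e *_) (M≡WWᵀ e)) ⟩
    sumEdge n (λ e → x e * sumTriangle n (λ t → W n e t * Wᵀ n x t))
      ≡⟨ sum-cong E (λ e → sym (sum-*ˡ Tr (x e) (λ t → W n e t * Wᵀ n x t))) ⟩
    sumEdge n (λ e → sumTriangle n (λ t → x e * (W n e t * Wᵀ n x t)))
      ≡⟨ sum-sumTriangle-swap E n (λ e t → x e * (W n e t * Wᵀ n x t)) ⟩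
    sumTriangle n (λ t → sumEdge n (λ e → x e * (W n e t * Wᵀ n x t)))
      ≡⟨ sum-cong Tr (λ t → sum-cong E (λ e → rearrange (x e) (W n e t) (Wᵀ n x t))) ⟩
    sumTriangle n (λ t → sumEdge n (λ e → W n e t * x e * Wᵀ n x t))
      ≡⟨ sum-cong Tr (λ t → sum-*ʳ E (Wᵀ n x t) (λ e → W n e t * x e)) ⟩
    sumTriangle n (λ t → Wᵀ n x t * Wᵀ n x t) ∎
    where
    rearrange : ∀ a b c → a * (b * c) ≡ b * a * c
    rearrange = solve 3 (λ a b c → a :* (b :* c) := b :* a :* c) refl

  kerM⇒vanishesOnTriangles : (∀ e → sumEdge n (λ g → M n e g * x g) ≡ 0ℚ) →
                             VanishesOnTriangles n x
  kerM⇒vanishesOnTriangles Mx≡0 a b c = begin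
    x (p₀ , b , c) + (x (p₁ , a , c) + x (p₂ , a , b))
      ≡⟨ cong (λ q → x (p₀ , b , c) + (x (p₁ , a , c) + q)) (sym (ℚₚ.+-identityʳ _)) ⟩
    x (p₀ , b , c) + (x (p₁ , a , c) + (x (p₂ , a , b) + 0ℚ))
      ≡⟨ sym (Wᵀ-triangle (triangle a b c)) ⟩
    Wᵀ n x (triangle a b c)
      ≡⟨ sumFin³-squares≡0 n {λ a b c → Wᵀ n x (triangle a b c)} |Wᵀx|²≡0 a b c ⟩
    0ℚ ∎
    where
    triangle : Fin n → Fin n → Fin n → Triangle n
    triangle a b c = λ { p₀ → a ; p₁ → b ; p₂ → c }

    |Wᵀx|²≡0 : sumTriangle n (λ t → Wᵀ n x t * Wᵀ n x t) ≡ 0ℚ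
    |Wᵀx|²≡0 = begin
      sumTriangle n (λ t → Wᵀ n x t * Wᵀ n x t)
        ≡⟨ sym quadratic-form-M ⟩
      sumEdge n (λ e → x e * sumEdge n (λ g → M n e g * x g))
        ≡⟨ sum-cong E (λ e → trans (cong (x e *_) (Mx≡0 e)) (ℚₚ.*-zeroʳ (x e))) ⟩
      sumEdge n (λ _ → 0ℚ)
        ≡⟨ sum-zero E ⟩
      0ℚ ∎

T-⇔⇒≡ : ∀ {a b} → T a ⇔ T b → a ≡ b
T-⇔⇒≡ Ta⇔Tb = ⇔→≡ {z = true} (T-≡ ⇔-∘ (Ta⇔Tb ⇔-∘ ⇔-sym T-≡))

T-anyFin : ∀ n (f : Fin n → Bool) → T (anyFin n f) ⇔ ∃ λ i → T (f i)
T-anyFin zero    f = mk⇔ (λ ()) (λ ())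
T-anyFin (suc n) f = Finₚ.⊎⇔∃ ⇔-∘ ((⇔-id _ ⊎-⇔ T-anyFin n (f ∘ suc)) ⇔-∘ T-∨)

T-vertexEq : ∀ {n} {u v : Vertex n} → T (vertexEq u v) ⇔ u ≡ v
T-vertexEq {u = p , a} {q , b} = mk⇔
  (λ eq → let p≡q , a≡b = to (T-∧ {⌊ p ≟ q ⌋}) eq in cong₂ _,_ (toWitness p≡q) (toWitness a≡b))
  (λ { refl → from T-∧ (fromWitness {a? = p ≟ p} refl , fromWitness {a? = a ≟ a} refl) })

T-anyEdge : ∀ {n} (P : Edge n → Bool) →
  T (anyFin 3 (λ k → anyFin n (λ a → anyFin n (λ b → P (k , a , b))))) ⇔ ∃ λ e → T (P e)
T-anyEdge {n} P = mk⇔ found witness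
  where
  anyB : Fin 3 → Fin n → Bool
  anyB k a = anyFin n (λ b → P (k , a , b))
  anyA : Fin 3 → Bool
  anyA k = anyFin n (anyB k)

  found : T (anyFin 3 anyA) → ∃ λ e → T (P e)
  found t = let k , t₁ = to (T-anyFin 3 anyA) t
                a , t₂ = to (T-anyFin n (anyB k)) t₁
                b , t₃ = to (T-anyFin n (λ b → P (k , a , b))) t₂
            in (k , a , b) , t₃

  witness : (∃ λ e → T (P e)) → T (anyFin 3 anyA)
  witness ((k , a , b) , t) = from (T-anyFin 3 anyA)
    (k , from (T-anyFin n (anyB k)) (a , from (T-anyFin n (λ b → P (k , a , b))) (b , t)))

Joins : ∀ {n} → Edge n → Vertex n → Vertex n → Set
Joins e u v = (end₁ e ≡ u × end₂ e ≡ v) ⊎ (end₁ e ≡ v × end₂ e ≡ u)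

lowPart<highPart : ∀ k → lowPart k Fin.< highPart k
lowPart<highPart p₀ = ℕ.s≤s (ℕ.s≤s ℕ.z≤n)
lowPart<highPart p₁ = ℕ.s≤s ℕ.z≤n
lowPart<highPart p₂ = ℕ.s≤s ℕ.z≤n

parts-injective : ∀ k k' → lowPart k ≡ lowPart k' → highPart k ≡ highPart k' → k ≡ k'
parts-injective p₀ p₀ _  _  = refl
parts-injective p₀ p₁ () _
parts-injective p₀ p₂ () _
parts-injective p₁ p₀ () _
parts-injective p₁ p₁ _  _  = refl
parts-injective p₁ p₂ _  ()
parts-injective p₂ p₀ () _
parts-injective p₂ p₁ _  ()
parts-injective p₂ p₂ _  _  = refl

ends-injective : ∀ {n} {e f : Edge n} → end₁ e ≡ end₁ f → end₂ e ≡ end₂ f → e ≡ f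
ends-injective {e = k , a , b} {k' , a' , b'} p q
  with low≡ , refl ← ,-injective p | high≡ , refl ← ,-injective q
  with refl ← parts-injective k k' low≡ high≡ = refl

ends-not-reversed : ∀ {n} {e f : Edge n} → end₁ e ≡ end₂ f → end₂ e ≡ end₁ f → ⊥
ends-not-reversed {e = k , _} {k' , _} p q =
  Finₚ.<-asym (subst (Fin._< highPart k) (proj₁ (,-injective p)) (lowPart<highPart k))
              (subst (Fin._< highPart k') (sym (proj₁ (,-injective q))) (lowPart<highPart k'))

joins-unique : ∀ {n} {e f : Edge n} {u v} → Joins e u v → Joins f u v → e ≡ f
joins-unique (inj₁ (refl , refl)) (inj₁ (p , q)) = ends-injective (sym p) (sym q)
joins-unique (inj₁ (refl , refl)) (inj₂ (p , q)) = ⊥-elim (ends-not-reversed (sym q) (sym p))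
joins-unique (inj₂ (refl , refl)) (inj₁ (p , q)) = ⊥-elim (ends-not-reversed (sym q) (sym p))
joins-unique (inj₂ (refl , refl)) (inj₂ (p , q)) = ends-injective (sym p) (sym q)

adj-joins : ∀ {n} (G : Subgraph n) {e u v} → Joins e u v → adj G u v ≡ G e
adj-joins G {e} {u} {v} e-joins = T-⇔⇒≡ (mk⇔ adj⇒G G⇒adj)
  where
  joinsB : Edge _ → Bool
  joinsB f = (vertexEq (end₁ f) u ∧ vertexEq (end₂ f) v) ∨ (vertexEq (end₁ f) v ∧ vertexEq (end₂ f) u)

  T-joinsB : ∀ {f} → T (joinsB f) ⇔ Joins f u v
  T-joinsB = (((T-vertexEq ×-⇔ T-vertexEq) ⇔-∘ T-∧) ⊎-⇔ ((T-vertexEq ×-⇔ T-vertexEq) ⇔-∘ T-∧)) ⇔-∘ T-∨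

  adj⇒G : T (adj G u v) → T (G e)
  adj⇒G t = let f , t′ = to (T-anyEdge (λ f → G f ∧ joinsB f)) t
                Gf , f-joins = to T-∧ t′
            in subst (T ∘ G) (joins-unique (to T-joinsB f-joins) e-joins) Gf

  G⇒adj : T (G e) → T (adj G u v)
  G⇒adj Ge = from (T-anyEdge (λ f → G f ∧ joinsB f)) (e , from T-∧ (Ge , from T-joinsB e-joins))

countFin-cong : ∀ n {h h' : Fin n → Bool} → (∀ i → h i ≡ h' i) → countFin n h ≡ countFin n h'
countFin-cong zero    h≗h' = refl
countFin-cong (suc n) h≗h' rewrite h≗h' zero = cong (_ ℕ.+_) (countFin-cong n (h≗h' ∘ suc))

sumFin-𝟙-countFin : ∀ n {h h' : Fin n → Bool} →
  countFin n h ≡ countFin n h' → sumFin n (𝟙 ∘ h) ≡ sumFin n (𝟙 ∘ h')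
sumFin-𝟙-countFin n {h} {h'} #h≡#h' =
  trans (sumFin-𝟙 n h) (trans (cong fromℕ #h≡#h') (sym (sumFin-𝟙 n h')))
  where
  fromℕ : ℕ → ℚ
  fromℕ zero    = 0ℚ
  fromℕ (suc k) = 1ℚ + fromℕ k

  sumFin-𝟙 : ∀ n (h : Fin n → Bool) → sumFin n (𝟙 ∘ h) ≡ fromℕ (countFin n h)
  sumFin-𝟙 zero    h = refl
  sumFin-𝟙 (suc n) h with h zero
  ... | true  = cong (1ℚ +_) (sumFin-𝟙 n (h ∘ suc))
  ... | false = trans (ℚₚ.+-identityˡ _) (sumFin-𝟙 n (h ∘ suc))

-- The degrees of (lowPart k , a) into highPart k and of (highPart k , b) into lowPart k.
rowDeg colDeg : ∀ {n} → Subgraph n → Fin 3 → Fin n → ℚ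
rowDeg {n} G k a = sumFin n (λ b → 𝟙 (G (k , a , b)))
colDeg {n} G k b = sumFin n (λ a → 𝟙 (G (k , a , b)))

module _ {n} (G : Subgraph n) (balanced : LocallyBalanced G) where

  degrees-balanced : ∀ p a q r → q ≢ p → r ≢ p → {h h' : Fin n → Bool} →
    (∀ b → adj G (p , a) (q , b) ≡ h b) → (∀ b → adj G (p , a) (r , b) ≡ h' b) →
    sumFin n (𝟙 ∘ h) ≡ sumFin n (𝟙 ∘ h')
  degrees-balanced p a q r q≢p r≢p adj≗h adj≗h' = sumFin-𝟙-countFin n
    (trans (sym (countFin-cong n adj≗h)) (trans (balanced p a q r q≢p r≢p) (countFin-cong n adj≗h')))

  balanced-at-p₀ : ∀ a → rowDeg G p₂ a ≡ rowDeg G p₁ a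
  balanced-at-p₀ a = degrees-balanced p₀ a p₁ p₂ (λ ()) (λ ())
    (λ b → adj-joins G {p₂ , a , b} (inj₁ (refl , refl)))
    (λ b → adj-joins G {p₁ , a , b} (inj₁ (refl , refl)))

  balanced-at-p₁ : ∀ a → colDeg G p₂ a ≡ rowDeg G p₀ a
  balanced-at-p₁ a = degrees-balanced p₁ a p₀ p₂ (λ ()) (λ ())
    (λ b → adj-joins G {p₂ , b , a} (inj₂ (refl , refl)))
    (λ b → adj-joins G {p₀ , a , b} (inj₁ (refl , refl)))

  balanced-at-p₂ : ∀ a → colDeg G p₀ a ≡ colDeg G p₁ a
  balanced-at-p₂ a = degrees-balanced p₂ a p₁ p₀ (λ ()) (λ ())
    (λ b → adj-joins G {p₀ , b , a} (inj₂ (refl , refl)))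
    (λ b → adj-joins G {p₁ , b , a} (inj₂ (refl , refl)))

weight-on-part : ∀ {n} (G : Subgraph n) (x : Edge n → ℚ) k (α β : Fin n → ℚ) →
  (∀ a b → x (k , a , b) ≡ α a + β b) →
  sumFin n (λ a → sumFin n (λ b → 𝟙 (G (k , a , b)) * x (k , a , b))) ≡
  sumFin n (λ a → α a * rowDeg G k a) + sumFin n (λ b → β b * colDeg G k b)
weight-on-part {n} G x k α β x≡α+β =
  trans (sumFin-cong n (λ a → sumFin-cong n (λ b → cong (𝟙 (G (k , a , b)) *_) (x≡α+β a b))))
        (sumFin²-separable n (λ a b → 𝟙 (G (k , a , b))) α β)

-- With o a fixed index, each identity below is an alternating sum of the triangle
-- conditions for triangles whose corners have indices among a, b, c and o.
module VertexPotentials (m : ℕ) (x : Edge (suc m) → ℚ) (vanishes : VanishesOnTriangles (suc m) x) where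

  o : Fin (suc m)
  o = zero

  u w δ : Fin (suc m) → ℚ
  u a = x (p₁ , a , o)
  w b = x (p₀ , b , o)
  δ c = x (p₁ , o , c) + - x (p₁ , o , o)

  private
    ≡+vanishing : ∀ {l r e} → l ≡ r + e → e ≡ 0ℚ → l ≡ r
    ≡+vanishing {r = r} l≡r+e refl = trans l≡r+e (ℚₚ.+-identityʳ r)

    difference≡0 : ∀ {a b} → a ≡ 0ℚ → b ≡ 0ℚ → a + - b ≡ 0ℚ
    difference≡0 refl refl = refl

  x₂-potential : ∀ a b → x (p₂ , a , b) ≡ - u a + - w b
  x₂-potential a b = ≡+vanishing (identity (x (p₂ , a , b)) (u a) (w b)) (vanishes a b o)
    where
    identity : ∀ x₂ u w → x₂ ≡ (- u + - w) + (w + (u + x₂))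
    identity = solve 3 (λ x₂ u w → x₂ := (:- u :+ :- w) :+ (w :+ (u :+ x₂))) refl

  x₀-potential : ∀ b c → x (p₀ , b , c) ≡ w b + - δ c
  x₀-potential b c =
    ≡+vanishing (identity (x (p₀ , b , c)) (w b) (x (p₁ , o , c)) (x (p₁ , o , o)) (x (p₂ , o , b)))
                (difference≡0 (vanishes o b c) (vanishes o b o))
    where
    identity : ∀ x₀ w x₁ x₁′ x₂ → x₀ ≡ (w + - (x₁ + - x₁′)) + ((x₀ + (x₁ + x₂)) + - (w + (x₁′ + x₂)))
    identity = solve 5 (λ x₀ w x₁ x₁′ x₂ →
      x₀ := (w :+ :- (x₁ :+ :- x₁′)) :+ ((x₀ :+ (x₁ :+ x₂)) :+ :- (w :+ (x₁′ :+ x₂)))) refl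

  x₁-potential : ∀ a c → x (p₁ , a , c) ≡ u a + δ c
  x₁-potential a c =
    ≡+vanishing (identity (x (p₁ , a , c)) (u a) (x (p₁ , o , c)) (x (p₁ , o , o))
                          (x (p₀ , o , c)) (x (p₀ , o , o)) (x (p₂ , a , o)) (x (p₂ , o , o)))
                (difference≡0 (difference≡0 (vanishes a o c) (vanishes a o o))
                              (difference≡0 (vanishes o o c) (vanishes o o o)))
    where
    identity : ∀ x₁ u x₁ᶜ x₁ᵒ x₀ᶜ x₀ᵒ x₂ x₂ᵒ →
      x₁ ≡ (u + (x₁ᶜ + - x₁ᵒ)) +
           (((x₀ᶜ + (x₁ + x₂)) + - (x₀ᵒ + (u + x₂))) + - ((x₀ᶜ + (x₁ᶜ + x₂ᵒ)) + - (x₀ᵒ + (x₁ᵒ + x₂ᵒ))))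
    identity = solve 8 (λ x₁ u x₁ᶜ x₁ᵒ x₀ᶜ x₀ᵒ x₂ x₂ᵒ →
      x₁ := (u :+ (x₁ᶜ :+ :- x₁ᵒ)) :+
            (((x₀ᶜ :+ (x₁ :+ x₂)) :+ :- (x₀ᵒ :+ (u :+ x₂))) :+ :- ((x₀ᶜ :+ (x₁ᶜ :+ x₂ᵒ)) :+ :- (x₀ᵒ :+ (x₁ᵒ :+ x₂ᵒ))))) refl

locallyBalanced-weight≡0 : ∀ {m} (G : Subgraph (suc m)) → LocallyBalanced G →
  (x : Edge (suc m) → ℚ) → VanishesOnTriangles (suc m) x →
  sumEdge (suc m) (λ f → 𝟙 (G f) * x f) ≡ 0ℚ
locallyBalanced-weight≡0 {m} G balanced x vanishes = begin
  sumEdge n (λ f → 𝟙 (G f) * x f)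
    ≡⟨ cong₂ _+_ part₀ (cong₂ _+_ part₁ (cong (_+ 0ℚ) part₂)) ⟩
  (A + - B) + ((C + B) + ((- C + - A) + 0ℚ))
    ≡⟨ solve 3 (λ A B C → (A :+ :- B) :+ ((C :+ B) :+ ((:- C :+ :- A) :+ con 0ℚ)) := con 0ℚ) refl A B C ⟩
  0ℚ ∎
  where
  open VertexPotentials m x vanishes
  n = suc m

  A B C : ℚ
  A = sumFin n (λ b → w b * rowDeg G p₀ b)
  B = sumFin n (λ c → δ c * colDeg G p₁ c)
  C = sumFin n (λ a → u a * rowDeg G p₁ a)

  weight : Fin 3 → ℚ
  weight k = sumFin n (λ a → sumFin n (λ b → 𝟙 (G (k , a , b)) * x (k , a , b)))

  part₀ : weight p₀ ≡ A + - B
  part₀ = trans (weight-on-part G x p₀ w (λ c → - δ c) x₀-potential)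
    (cong (A +_) (trans (sumFin-cong n (λ c → cong (- δ c *_) (balanced-at-p₂ G balanced c)))
                        (sumFin-neg-*ˡ n δ (colDeg G p₁))))

  part₁ : weight p₁ ≡ C + B
  part₁ = weight-on-part G x p₁ u δ x₁-potential

  part₂ : weight p₂ ≡ - C + - A
  part₂ = trans (weight-on-part G x p₂ (λ a → - u a) (λ b → - w b) x₂-potential)
    (cong₂ _+_
      (trans (sumFin-cong n (λ a → cong (- u a *_) (balanced-at-p₀ G balanced a)))
             (sumFin-neg-*ˡ n u (rowDeg G p₁)))
      (trans (sumFin-cong n (λ b → cong (- w b *_) (balanced-at-p₁ G balanced b)))
             (sumFin-neg-*ˡ n w (rowDeg G p₀))))

proposition2p4 : (n : ℕ) (G : Subgraph n) → LocallyBalanced G →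
    (K : Edge n → Edge n → ℚ) → IsOrthProjOntoKerM n K →
    ∀ e → G e ≡ true → principalTimesOnes n K G e ≡ 0ℚ
proposition2p4 zero    G balanced K _ (_ , () , _) _
proposition2p4 (suc m) G balanced K (MK≡0 , _ , K-sym) e _ = begin
  principalTimesOnes (suc m) K G e
    ≡⟨ sum-cong E (λ f → if-then-0≡𝟙* (G f) (K e f)) ⟩
  sumEdge (suc m) (λ f → 𝟙 (G f) * K e f)
    ≡⟨ locallyBalanced-weight≡0 G balanced (K e) (kerM⇒vanishesOnTriangles (suc m) (K e) Ke∈kerM) ⟩
  0ℚ ∎
  where
  E = edge-summation (suc m)

  Ke∈kerM : ∀ d → sumEdge (suc m) (λ f → M (suc m) d f * K e f) ≡ 0ℚ
  Ke∈kerM d = trans (sum-cong E (λ f → cong (M (suc m) d f *_) (K-sym e f))) (MK≡0 d e)
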